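{- Let $G$ be a finite simple graph, let $k\ge 1$, and fix $f\in M_{k-1}(G)$. Then $$\mathscr{C}(G^{(k)})=\mathscr{C}(Gf)\oplus\ker(p^*),$$ where $p^*:\mathscr{C}(G^{(k)})\to\mathscr{C}(G)$ is the linear map described below.
   Context: For a graph $H$, the edge space $\mathscr{E}(H)$ is the $\mathbb{F}_2$-vector space of subsets of $E(H)$ (addition = symmetric difference); the boundary map $\delta_H$ sends an edge $xy$ to $x+y$ in the $\mathbb{F}_2$-vector space of subsets of $V(H)$; the cycle space is $\mathscr{C}(H)=\ker\delta_H$ (elements are identified with subgraphs all of whose vertices have even degree). For $G$ with vertex set $\{a_1,\ldots,a_v\}$, $M_k(G)$ is the set of monic monomials of degree $k$ in commuting indeterminates $a_1,\ldots,a_v$ ($M_0(G)=\{1\}$). The reduced $k$th power $G^{(k)}$ has vertex set $M_k(G)$, and for every edge $ab$ of $G$ and every $g\in M_{k-1}(G)$ there is an edge between $ag$ and $bg$; these are all the edges. For fixed $f\in M_{k-1}(G)$, $Gf$ is the induced subgraph of $G^{(k)}$ on $\{xf: x\in V(G)\}$ (isomorphic to $G$ via $x\mapsto xf$), and $\mathscr{C}(Gf)$ is viewed as a subspace of $\mathscr{C}(G^{(k)})$. The map $p^*$ is the linear map $\mathscr{E}(G^{(k)})\to\mathscr{E}(G)$ given on edges by $p^*(ag\;bg)=ab$ (for $ab\in E(G)$, $g\in M_{k-1}(G)$), restricted to $\mathscr{C}(G^{(k)})$; its image lies in $\mathscr{C}(G)$. -}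

module Defs where

open import Data.Nat using (ℕ; zero; suc; _∸_; _<ᵇ_; _≡ᵇ_)
open import Data.Fin using (Fin; toℕ)
import Data.Fin as Fin
open import Data.Vec using (Vec; []; _∷_)
open import Data.Bool using (Bool; true; false; T; _∧_; _xor_)
open import Data.Unit using (⊤; tt)
open import Data.Empty using (⊥)
open import Data.Product using (Σ; _×_; _,_; proj₁; proj₂)
open import Relation.Binary.PropositionalEquality using (_≡_)

record Graph : Set where
  field
    n      : ℕ
    Adj    : Fin n → Fin n → Bool
    sym    : ∀ a b → Adj a b ≡ Adj b a
    irrefl : ∀ a → Adj a a ≡ false
open Graph public

-- unordered edges {a,b} of G, represented canonically with toℕ a < toℕ b
isEdge : (G : Graph) → Fin (n G) → Fin (n G) → Bool
isEdge G a b = (toℕ a <ᵇ toℕ b) ∧ Adj G a b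

EdgeG : Graph → Set
EdgeG G = Σ (Fin (n G)) λ a → Σ (Fin (n G)) λ b → T (isEdge G a b)

-- Monic monomials of degree d in n commuting indeterminates, M_d.
-- A monomial a_1^{i_1} … a_n^{i_n} is encoded by choosing i_1 ≤ d and
-- then a monomial of degree d ∸ i_1 in the remaining indeterminates.

Mono : ℕ → ℕ → Set
Mono zero    zero    = ⊤
Mono zero    (suc d) = ⊥
Mono (suc n) d       = Σ (Fin (suc d)) λ i → Mono n (d ∸ toℕ i)

exps : ∀ n d → Mono n d → Vec ℕ n
exps zero    zero    tt      = []
exps zero    (suc d) ()
exps (suc n) d       (i , m) = toℕ i ∷ exps n (d ∸ toℕ i) m

incr : ∀ {n} → Fin n → Vec ℕ n → Vec ℕ n
incr Fin.zero    (x ∷ xs) = suc x ∷ xs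
incr (Fin.suc a) (x ∷ xs) = x ∷ incr a xs

eqV : ∀ {n} → Vec ℕ n → Vec ℕ n → Bool
eqV []       []       = true
eqV (x ∷ xs) (y ∷ ys) = (x ≡ᵇ y) ∧ eqV xs ys

sumFin : ∀ {m} → (Fin m → Bool) → Bool
sumFin {zero}  F = false
sumFin {suc m} F = F Fin.zero xor sumFin (λ i → F (Fin.suc i))

sumT : (b : Bool) → (T b → Bool) → Bool
sumT true  F = F tt
sumT false F = false

sumMono : ∀ n d → (Mono n d → Bool) → Bool
sumMono zero    zero    F = F tt
sumMono zero    (suc d) F = false
sumMono (suc n) d       F = sumFin λ i → sumMono n (d ∸ toℕ i) (λ m → F (i , m))

sumEdgeG : (G : Graph) → (EdgeG G → Bool) → Bool
sumEdgeG G F = sumFin λ a → sumFin λ b → sumT (isEdge G a b) (λ t → F (a , b , t))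

-- The reduced k-th power G^(k), with k = suc j.
-- Vertices: Mono (n G) (suc j).  Edges: indexed by (ab , g) with ab ∈ E(G),
-- g ∈ M_j = M_{k-1}; the edge (ab , g) joins ag and bg.

EdgeK : Graph → ℕ → Set
EdgeK G j = EdgeG G × Mono (n G) j

end₁ end₂ : (G : Graph) (j : ℕ) → EdgeK G j → Vec ℕ (n G)
end₁ G j ((a , b , _) , g) = incr a (exps (n G) j g)
end₂ G j ((a , b , _) , g) = incr b (exps (n G) j g)

-- edge spaces over F₂ (subsets as characteristic functions)
EdgeSpaceG : Graph → Set
EdgeSpaceG G = EdgeG G → Bool

EdgeSpaceK : Graph → ℕ → Set
EdgeSpaceK G j = EdgeK G j → Bool

δ : (G : Graph) (j : ℕ) → EdgeSpaceK G j → (Mono (n G) (suc j) → Bool)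
δ G j S m = sumEdgeG G λ e → sumMono (n G) j λ g →
  S (e , g) ∧ (eqV (exps (n G) (suc j) m) (end₁ G j (e , g))
               xor eqV (exps (n G) (suc j) m) (end₂ G j (e , g)))

IsCycle : (G : Graph) (j : ℕ) → EdgeSpaceK G j → Set
IsCycle G j S = ∀ m → δ G j S m ≡ false

-- an edge of G^(k) lies in the induced subgraph Gf iff both endpoints
-- are of the form x f with x ∈ V(G)
InGf : (G : Graph) (j : ℕ) → Mono (n G) j → EdgeK G j → Set
InGf G j f e =
  (Σ (Fin (n G)) λ x → end₁ G j e ≡ incr x (exps (n G) j f)) ×
  (Σ (Fin (n G)) λ y → end₂ G j e ≡ incr y (exps (n G) j f))

-- C(Gf) viewed as a subspace of C(G^(k)): cycles supported on edges of Gf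
InCGf : (G : Graph) (j : ℕ) → Mono (n G) j → EdgeSpaceK G j → Set
InCGf G j f S = IsCycle G j S × (∀ e → S e ≡ true → InGf G j f e)

pstar : (G : Graph) (j : ℕ) → EdgeSpaceK G j → EdgeSpaceG G
pstar G j S e = sumMono (n G) j λ g → S (e , g)

InKerP : (G : Graph) (j : ℕ) → EdgeSpaceK G j → Set
InKerP G j S = IsCycle G j S × (∀ e → pstar G j S e ≡ false)

module Submission where

-- Let S be a cycle of G^(k) and P = p*(S) ∈ E(G).
--  * P is a cycle of G.  Weighting every vertex m of G^(k) by the parity of
--    its exponent of a fixed indeterminate x, the edge (ab , g) contributes
--    [a = x] + [b = x] (the parities of ag and bg differ exactly there), so the
--    degree of x in P equals the weighted sum of the boundary of S, i.e. 0.
--  * Copying P onto the induced subgraph Gf (edge (ab , f) for ab ∈ P) gives a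
--    cycle X ∈ C(Gf) with p*(X) = P; hence Y = X + S is a cycle with p*(Y) = 0.
--  * Conversely, an edge (ab , g) of G^(k) with both ends of the form xf forces
--    g = f (a ≠ b), so a cycle in C(Gf) is supported on the single fibre g = f,
--    where p* is injective; thus C(Gf) ∩ ker p* = 0.

open import Defs
open import Data.Nat using (ℕ)
open import Data.Bool using (Bool; false; _xor_)
open import Data.Product using (Σ; _×_)
open import Relation.Binary.PropositionalEquality using (_≡_)

open import Algebra.Bundles using (CommutativeMonoid; CommutativeRing)
import Algebra.Properties.CommutativeSemigroup as CommutativeSemigroupProperties
open import Data.Bool using (true; not; _∧_; T)
open import Data.Bool.Properties
  using (xor-assoc; xor-same; xor-identityʳ; ∧-assoc; ∧-comm; ∧-zeroʳ;
         ∧-distribʳ-xor; ∧-commutativeMonoid; xor-∧-commutativeRing; T-∧; T-≡)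
open import Data.Fin using (Fin; toℕ; fromℕ<; _≟_)
import Data.Fin as Fin
open import Data.Fin.Properties using (toℕ-fromℕ<; toℕ≤pred[n])
open import Data.List using (List; []; _∷_; _++_; map; concatMap; tabulate; allFin)
open import Data.Nat using (zero; suc; _+_; _∸_; _≡ᵇ_; _≤_; _<_; s≤s)
open import Data.Nat.Properties
  using (m≤m+n; m+n∸m≡n; m+[n∸m]≡n; +-suc; suc-injective; n≤1+n; ≤-refl;
         ≤-trans; ≤-reflexive; 1+n≰n; ≡ᵇ⇒≡; ≡⇒≡ᵇ; <ᵇ⇒<; <-irrefl)
open import Data.Product using (_,_; proj₁; proj₂)
open import Data.Unit using (tt)
open import Data.Vec using (Vec; []; _∷_; lookup)
open import Data.Vec.Properties using (∷-injective)
open import Function.Bundles using (module Equivalence)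
open import Relation.Binary.PropositionalEquality
  using (refl; trans; cong; cong₂; _≢_; module ≡-Reasoning)
  renaming (sym to ≡-sym)
open import Relation.Nullary using (yes; no; contradiction)

open ≡-Reasoning

open CommutativeSemigroupProperties
  (CommutativeMonoid.commutativeSemigroup ∧-commutativeMonoid)
  using () renaming (x∙yz≈z∙xy to ∧-rotate)
open CommutativeSemigroupProperties
  (CommutativeRing.+-commutativeSemigroup xor-∧-commutativeRing)
  using () renaming (interchange to xor-interchange)

xor-cancelʳ : ∀ a b c → (a xor c) xor (b xor c) ≡ a xor b
xor-cancelʳ a b c = begin
  (a xor c) xor (b xor c)  ≡⟨ xor-interchange a c b c ⟩
  (a xor b) xor (c xor c)  ≡⟨ cong ((a xor b) xor_) (xor-same c) ⟩
  (a xor b) xor false      ≡⟨ xor-identityʳ (a xor b) ⟩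
  a xor b                  ∎

xor-involutive : ∀ a b → b ≡ a xor (a xor b)
xor-involutive a b = ≡-sym (begin
  a xor (a xor b)  ≡⟨ ≡-sym (xor-assoc a a b) ⟩
  (a xor a) xor b  ≡⟨ cong (_xor b) (xor-same a) ⟩
  b                ∎)

sumL : {A : Set} → List A → (A → Bool) → Bool
sumL []       F = false
sumL (x ∷ xs) F = F x xor sumL xs F

sumL-cong : {A : Set} (xs : List A) {F H : A → Bool} → (∀ x → F x ≡ H x) → sumL xs F ≡ sumL xs H
sumL-cong []       F≡H = refl
sumL-cong (x ∷ xs) F≡H = cong₂ _xor_ (F≡H x) (sumL-cong xs F≡H)

sumL-zero : {A : Set} (xs : List A) {F : A → Bool} → (∀ x → F x ≡ false) → sumL xs F ≡ false
sumL-zero []       F≡0 = refl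
sumL-zero (x ∷ xs) F≡0 = cong₂ _xor_ (F≡0 x) (sumL-zero xs F≡0)

sumL-xor : {A : Set} (xs : List A) (F H : A → Bool) →
  sumL xs (λ x → F x xor H x) ≡ sumL xs F xor sumL xs H
sumL-xor []       F H = refl
sumL-xor (x ∷ xs) F H = trans (cong ((F x xor H x) xor_) (sumL-xor xs F H))
                              (xor-interchange (F x) (H x) (sumL xs F) (sumL xs H))

sumL-∧ˡ : {A : Set} (xs : List A) (b : Bool) (F : A → Bool) → sumL xs (λ x → b ∧ F x) ≡ b ∧ sumL xs F
sumL-∧ˡ xs true  F = refl
sumL-∧ˡ xs false F = sumL-zero xs (λ _ → refl)

sumL-++ : {A : Set} (xs ys : List A) (F : A → Bool) → sumL (xs ++ ys) F ≡ sumL xs F xor sumL ys F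
sumL-++ []       ys F = refl
sumL-++ (x ∷ xs) ys F = trans (cong (F x xor_) (sumL-++ xs ys F)) (≡-sym (xor-assoc (F x) _ _))

sumL-map : {A B : Set} (h : A → B) (xs : List A) (F : B → Bool) →
  sumL (map h xs) F ≡ sumL xs (λ x → F (h x))
sumL-map h []       F = refl
sumL-map h (x ∷ xs) F = cong (F (h x) xor_) (sumL-map h xs F)

sumL-concatMap : {A B : Set} (h : A → List B) (xs : List A) (F : B → Bool) →
  sumL (concatMap h xs) F ≡ sumL xs (λ x → sumL (h x) F)
sumL-concatMap h []       F = refl
sumL-concatMap h (x ∷ xs) F =
  trans (sumL-++ (h x) (concatMap h xs) F) (cong (sumL (h x) F xor_) (sumL-concatMap h xs F))

sumL-swap : {A B : Set} (xs : List A) (ys : List B) (F : A → B → Bool) →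
  sumL xs (λ x → sumL ys (F x)) ≡ sumL ys (λ y → sumL xs (λ x → F x y))
sumL-swap []       ys F = ≡-sym (sumL-zero ys (λ _ → refl))
sumL-swap (x ∷ xs) ys F = trans (cong (sumL ys (F x) xor_) (sumL-swap xs ys F))
                                (≡-sym (sumL-xor ys (F x) (λ y → sumL xs (λ x → F x y))))

-- A summation operator is finite when it is the sum over some list.
-- Every sum in Defs is finite, so all list-sum laws transfer to them.
FiniteSum : {A : Set} → ((A → Bool) → Bool) → Set
FiniteSum {A} O = Σ (List A) λ xs → ∀ F → O F ≡ sumL xs F

module _ {A : Set} {O : (A → Bool) → Bool} (fin : FiniteSum O) where
  private
    xs = proj₁ fin
    O≡sumL = proj₂ fin

  sum-cong : {F H : A → Bool} → (∀ x → F x ≡ H x) → O F ≡ O H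
  sum-cong {F} {H} F≡H = trans (O≡sumL F) (trans (sumL-cong xs F≡H) (≡-sym (O≡sumL H)))

  sum-zero : {F : A → Bool} → (∀ x → F x ≡ false) → O F ≡ false
  sum-zero {F} F≡0 = trans (O≡sumL F) (sumL-zero xs F≡0)

  sum-xor : (F H : A → Bool) → O (λ x → F x xor H x) ≡ O F xor O H
  sum-xor F H = trans (O≡sumL _) (trans (sumL-xor xs F H) (≡-sym (cong₂ _xor_ (O≡sumL F) (O≡sumL H))))

  sum-∧ˡ : (b : Bool) (F : A → Bool) → O (λ x → b ∧ F x) ≡ b ∧ O F
  sum-∧ˡ b F = trans (O≡sumL _) (trans (sumL-∧ˡ xs b F) (cong (b ∧_) (≡-sym (O≡sumL F))))

  sum-∧ʳ : (b : Bool) (F : A → Bool) → O (λ x → F x ∧ b) ≡ O F ∧ b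
  sum-∧ʳ b F = trans (sum-cong (λ x → ∧-comm (F x) b)) (trans (sum-∧ˡ b F) (∧-comm b (O F)))

sum-swap : {A B : Set} {O₁ : (A → Bool) → Bool} {O₂ : (B → Bool) → Bool} →
  FiniteSum O₁ → FiniteSum O₂ → (F : A → B → Bool) →
  O₁ (λ x → O₂ (F x)) ≡ O₂ (λ y → O₁ (λ x → F x y))
sum-swap {O₁ = O₁} {O₂} (xs , O₁≡) (ys , O₂≡) F = begin
  O₁ (λ x → O₂ (F x))                    ≡⟨ O₁≡ _ ⟩
  sumL xs (λ x → O₂ (F x))               ≡⟨ sumL-cong xs (λ x → O₂≡ (F x)) ⟩
  sumL xs (λ x → sumL ys (F x))          ≡⟨ sumL-swap xs ys F ⟩
  sumL ys (λ y → sumL xs (λ x → F x y))  ≡⟨ ≡-sym (sumL-cong ys (λ y → O₁≡ (λ x → F x y))) ⟩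
  sumL ys (λ y → O₁ (λ x → F x y))       ≡⟨ ≡-sym (O₂≡ _) ⟩
  O₂ (λ y → O₁ (λ x → F x y))            ∎

sumFin-tabulate : {A : Set} {m : ℕ} (h : Fin m → A) (F : A → Bool) →
  sumFin (λ i → F (h i)) ≡ sumL (tabulate h) F
sumFin-tabulate {m = zero}  h F = refl
sumFin-tabulate {m = suc m} h F = cong (F (h Fin.zero) xor_) (sumFin-tabulate (λ i → h (Fin.suc i)) F)

sumFin-finite : ∀ m → FiniteSum (sumFin {m})
sumFin-finite m = allFin m , sumFin-tabulate (λ i → i)

sumT-finite : ∀ b → FiniteSum (sumT b)
sumT-finite true  = tt ∷ [] , λ F → ≡-sym (xor-identityʳ (F tt))
sumT-finite false = [] , λ F → refl

sumΣ : {A : Set} {B : A → Set} → ((A → Bool) → Bool) → ((a : A) → (B a → Bool) → Bool) →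
  (Σ A B → Bool) → Bool
sumΣ O₁ O₂ F = O₁ (λ a → O₂ a (λ b → F (a , b)))

sumΣ-finite : {A : Set} {B : A → Set} {O₁ : (A → Bool) → Bool} {O₂ : (a : A) → (B a → Bool) → Bool} →
  FiniteSum O₁ → ((a : A) → FiniteSum (O₂ a)) → FiniteSum (sumΣ O₁ O₂)
sumΣ-finite {B = B} {O₁} {O₂} (xs , O₁≡) fin₂ = concatMap pairs xs , λ F → begin
  O₁ (λ a → O₂ a (λ b → F (a , b)))      ≡⟨ O₁≡ _ ⟩
  sumL xs (λ a → O₂ a (λ b → F (a , b)))  ≡⟨ sumL-cong xs (λ a → trans (proj₂ (fin₂ a) _)
                                                  (≡-sym (sumL-map (λ b → a , b) (proj₁ (fin₂ a)) F))) ⟩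
  sumL xs (λ a → sumL (pairs a) F)        ≡⟨ ≡-sym (sumL-concatMap pairs xs F) ⟩
  sumL (concatMap pairs xs) F             ∎
  where
  pairs : ∀ a → List (Σ _ B)
  pairs a = map (λ b → a , b) (proj₁ (fin₂ a))

sumMono-finite : ∀ n d → FiniteSum (sumMono n d)
sumMono-finite zero    zero    = tt ∷ [] , λ F → ≡-sym (xor-identityʳ (F tt))
sumMono-finite zero    (suc d) = [] , λ F → refl
sumMono-finite (suc n) d       =
  sumΣ-finite (sumFin-finite (suc d)) (λ i → sumMono-finite n (d ∸ toℕ i))

sumEdgeG-finite : (G : Graph) → FiniteSum (sumEdgeG G)
sumEdgeG-finite G = sumΣ-finite (sumFin-finite (n G)) λ a →
                    sumΣ-finite (sumFin-finite (n G)) λ b → sumT-finite (isEdge G a b)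

degree : ∀ {n} → Vec ℕ n → ℕ
degree []       = 0
degree (x ∷ xs) = x + degree xs

degree-incr : ∀ {n} (a : Fin n) (v : Vec ℕ n) → degree (incr a v) ≡ suc (degree v)
degree-incr Fin.zero    (x ∷ v) = refl
degree-incr (Fin.suc a) (x ∷ v) = trans (cong (x +_) (degree-incr a v)) (+-suc x (degree v))

degree-exps : ∀ n d (m : Mono n d) → degree (exps n d m) ≡ d
degree-exps zero    zero    tt      = refl
degree-exps (suc n) d       (i , m) =
  trans (cong (toℕ i +_) (degree-exps n (d ∸ toℕ i) m)) (m+[n∸m]≡n (toℕ≤pred[n] i))

exps-onto : ∀ n d (v : Vec ℕ n) → degree v ≡ d → Σ (Mono n d) λ m → exps n d m ≡ v
exps-onto zero    .0                  []       refl = tt , refl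
exps-onto (suc n) .(v₀ + degree vs) (v₀ ∷ vs) refl =
  (fromℕ< v₀<d , proj₁ rest) , cong₂ _∷_ (toℕ-fromℕ< v₀<d) (proj₂ rest)
  where
  v₀<d : v₀ < suc (v₀ + degree vs)
  v₀<d = s≤s (m≤m+n v₀ (degree vs))
  remaining : degree vs ≡ v₀ + degree vs ∸ toℕ (fromℕ< v₀<d)
  remaining = trans (≡-sym (m+n∸m≡n v₀ (degree vs)))
                    (cong (v₀ + degree vs ∸_) (≡-sym (toℕ-fromℕ< v₀<d)))
  rest = exps-onto n _ vs remaining

eqV-refl : ∀ {n} (v : Vec ℕ n) → T (eqV v v)
eqV-refl []      = tt
eqV-refl (x ∷ v) = Equivalence.from T-∧ (≡⇒≡ᵇ x x refl , eqV-refl v)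

eqV-complete : ∀ {n} {u v : Vec ℕ n} → u ≡ v → eqV u v ≡ true
eqV-complete {v = v} refl = Equivalence.to T-≡ (eqV-refl v)

eqV-sound : ∀ {n} (u v : Vec ℕ n) → T (eqV u v) → u ≡ v
eqV-sound []      []      _  = refl
eqV-sound (x ∷ u) (y ∷ v) eq with Equivalence.to T-∧ eq
... | x≡y , u≡v = cong₂ _∷_ (≡ᵇ⇒≡ x y x≡y) (eqV-sound u v u≡v)

kron : ∀ {m} → Fin m → Fin m → Bool
kron a x = toℕ x ≡ᵇ toℕ a

sumFin-kron : ∀ {m} (a : Fin m) (H : Fin m → Bool) → sumFin (λ x → kron a x ∧ H x) ≡ H a
sumFin-kron {suc m} Fin.zero    H =
  trans (cong (H Fin.zero xor_) (sum-zero (sumFin-finite m) (λ _ → refl))) (xor-identityʳ (H Fin.zero))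
sumFin-kron {suc m} (Fin.suc a) H = sumFin-kron a (λ x → H (Fin.suc x))

sumMono-kron : ∀ n d (m₀ : Mono n d) (H : Mono n d → Bool) →
  sumMono n d (λ m → eqV (exps n d m) (exps n d m₀) ∧ H m) ≡ H m₀
sumMono-kron zero    zero tt        H = refl
sumMono-kron (suc n) d    (i₀ , m₀) H = begin
  sumFin (λ i → sumMono n (d ∸ toℕ i) (λ m → (kron i₀ i ∧ same i m) ∧ H (i , m)))
    ≡⟨ sum-cong (sumFin-finite (suc d)) (λ i →
         trans (sum-cong (sumMono-finite n _) (λ m → ∧-assoc (kron i₀ i) (same i m) (H (i , m))))
               (sum-∧ˡ (sumMono-finite n _) (kron i₀ i) (λ m → same i m ∧ H (i , m)))) ⟩
  sumFin (λ i → kron i₀ i ∧ sumMono n (d ∸ toℕ i) (λ m → same i m ∧ H (i , m)))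
    ≡⟨ sumFin-kron i₀ (λ i → sumMono n (d ∸ toℕ i) (λ m → same i m ∧ H (i , m))) ⟩
  sumMono n (d ∸ toℕ i₀) (λ m → same i₀ m ∧ H (i₀ , m))
    ≡⟨ sumMono-kron n (d ∸ toℕ i₀) m₀ (λ m → H (i₀ , m)) ⟩
  H (i₀ , m₀) ∎
  where
  same : (i : Fin (suc d)) → Mono n (d ∸ toℕ i) → Bool
  same i m = eqV (exps n (d ∸ toℕ i) m) (exps n (d ∸ toℕ i₀) m₀)

sumMono-point : ∀ n d (v : Vec ℕ n) → degree v ≡ d → (H : Vec ℕ n → Bool) →
  sumMono n d (λ m → eqV (exps n d m) v ∧ H (exps n d m)) ≡ H v
sumMono-point n d v deg H with exps-onto n d v deg
... | m₀ , refl = sumMono-kron n d m₀ (λ m → H (exps n d m))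

sumMono-concentrated : ∀ n d (m₀ : Mono n d) (H : Mono n d → Bool) →
  (∀ m → H m ≡ true → exps n d m ≡ exps n d m₀) → sumMono n d H ≡ H m₀
sumMono-concentrated n d m₀ H supported =
  trans (sum-cong (sumMono-finite n d) restrict) (sumMono-kron n d m₀ H)
  where
  restrict : ∀ m → H m ≡ eqV (exps n d m) (exps n d m₀) ∧ H m
  restrict m with H m in Hm
  ... | false = ≡-sym (∧-zeroʳ _)
  ... | true  = ≡-sym (cong (_∧ true) (eqV-complete (supported m Hm)))

odd : ℕ → Bool
odd zero    = false
odd (suc k) = not (odd k)

odd-incr : ∀ {n} (a x : Fin n) (v : Vec ℕ n) → odd (lookup (incr a v) x) ≡ kron a x xor odd (lookup v x)
odd-incr Fin.zero    Fin.zero    (y ∷ v) = refl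
odd-incr Fin.zero    (Fin.suc x) (y ∷ v) = refl
odd-incr (Fin.suc a) Fin.zero    (y ∷ v) = refl
odd-incr (Fin.suc a) (Fin.suc x) (y ∷ v) = odd-incr a x v

lookup-incr-same : ∀ {n} (a : Fin n) (u : Vec ℕ n) → lookup (incr a u) a ≡ suc (lookup u a)
lookup-incr-same Fin.zero    (x ∷ u) = refl
lookup-incr-same (Fin.suc a) (x ∷ u) = lookup-incr-same a u

lookup-incr-other : ∀ {n} (a z : Fin n) (u : Vec ℕ n) → a ≢ z → lookup (incr a u) z ≡ lookup u z
lookup-incr-other Fin.zero    Fin.zero    (x ∷ u) a≢z = contradiction refl a≢z
lookup-incr-other Fin.zero    (Fin.suc z) (x ∷ u) a≢z = refl
lookup-incr-other (Fin.suc a) Fin.zero    (x ∷ u) a≢z = refl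
lookup-incr-other (Fin.suc a) (Fin.suc z) (x ∷ u) a≢z = lookup-incr-other a z u (λ a≡z → a≢z (cong Fin.suc a≡z))

lookup-incr-≥ : ∀ {n} (y z : Fin n) (u : Vec ℕ n) → lookup u z ≤ lookup (incr y u) z
lookup-incr-≥ Fin.zero    Fin.zero    (x ∷ u) = n≤1+n x
lookup-incr-≥ Fin.zero    (Fin.suc z) (x ∷ u) = ≤-refl
lookup-incr-≥ (Fin.suc y) Fin.zero    (x ∷ u) = ≤-refl
lookup-incr-≥ (Fin.suc y) (Fin.suc z) (x ∷ u) = lookup-incr-≥ y z u

incr-injective : ∀ {n} (a : Fin n) (u w : Vec ℕ n) → incr a u ≡ incr a w → u ≡ w
incr-injective Fin.zero    (x ∷ u) (y ∷ w) eq with ∷-injective eq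
... | sx≡sy , u≡w = cong₂ _∷_ (suc-injective sx≡sy) u≡w
incr-injective (Fin.suc a) (x ∷ u) (y ∷ w) eq with ∷-injective eq
... | x≡y , au≡aw = cong₂ _∷_ x≡y (incr-injective a u w au≡aw)

-- If x ≠ a, comparing exponents of a gives u_a + 1 = w_a ≤ (yw)_a = u_a.
incr-common-cofactor : ∀ {n} (a b x y : Fin n) (u w : Vec ℕ n) → a ≢ b →
  incr a u ≡ incr x w → incr b u ≡ incr y w → u ≡ w
incr-common-cofactor a b x y u w a≢b au≡xw bu≡yw with x ≟ a
... | yes refl = incr-injective x u w au≡xw
... | no  x≢a  = contradiction (≤-trans u_a<w_a w_a≤u_a) (1+n≰n {lookup u a})
  where
  u_a<w_a : suc (lookup u a) ≤ lookup w a
  u_a<w_a = ≤-reflexive (begin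
    suc (lookup u a)        ≡⟨ ≡-sym (lookup-incr-same a u) ⟩
    lookup (incr a u) a     ≡⟨ cong (λ v → lookup v a) au≡xw ⟩
    lookup (incr x w) a     ≡⟨ lookup-incr-other x a w x≢a ⟩
    lookup w a              ∎)
  w_a≤u_a : lookup w a ≤ lookup u a
  w_a≤u_a = ≤-trans (lookup-incr-≥ y a w) (≤-reflexive (begin
    lookup (incr y w) a     ≡⟨ cong (λ v → lookup v a) (≡-sym bu≡yw) ⟩
    lookup (incr b u) a     ≡⟨ lookup-incr-other b a u (λ b≡a → a≢b (≡-sym b≡a)) ⟩
    lookup u a              ∎))

edge-endpoints-distinct : (G : Graph) (a b : Fin (n G)) → T (isEdge G a b) → a ≢ b
edge-endpoints-distinct G a b ab∈E refl =
  <-irrefl refl (<ᵇ⇒< (toℕ a) (toℕ a) (proj₁ (Equivalence.to T-∧ ab∈E)))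

incident : (G : Graph) → EdgeG G → Fin (n G) → Bool
incident G (a , b , _) x = kron a x xor kron b x

∂G : (G : Graph) → EdgeSpaceG G → Fin (n G) → Bool
∂G G P x = sumEdgeG G (λ e → P e ∧ incident G e x)

IsCycleG : (G : Graph) → EdgeSpaceG G → Set
IsCycleG G P = ∀ x → ∂G G P x ≡ false

module _ (G : Graph) (j : ℕ) where
  private
    N = n G
    ex  = exps N j
    ex₁ = exps N (suc j)
    finE  = sumEdgeG-finite G
    finM  = sumMono-finite N j
    finM₁ = sumMono-finite N (suc j)
    finF  = sumFin-finite N

  incidentK : EdgeK G j → Mono N (suc j) → Bool
  incidentK ε m = eqV (ex₁ m) (end₁ G j ε) xor eqV (ex₁ m) (end₂ G j ε)

  incidentK-sum : (ε : EdgeK G j) (w : Vec ℕ N → Bool) →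
    sumMono N (suc j) (λ m → incidentK ε m ∧ w (ex₁ m)) ≡ w (end₁ G j ε) xor w (end₂ G j ε)
  incidentK-sum ε@((a , b , _) , g) w = begin
    sumMono N (suc j) (λ m → incidentK ε m ∧ w (ex₁ m))
      ≡⟨ sum-cong finM₁ (λ m → ∧-distribʳ-xor (w (ex₁ m)) (at (incr a (ex g)) m) (at (incr b (ex g)) m)) ⟩
    sumMono N (suc j) (λ m → (at (incr a (ex g)) m ∧ w (ex₁ m)) xor (at (incr b (ex g)) m ∧ w (ex₁ m)))
      ≡⟨ sum-xor finM₁ (λ m → at (incr a (ex g)) m ∧ w (ex₁ m)) (λ m → at (incr b (ex g)) m ∧ w (ex₁ m)) ⟩
    sumMono N (suc j) (λ m → at (incr a (ex g)) m ∧ w (ex₁ m))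
      xor sumMono N (suc j) (λ m → at (incr b (ex g)) m ∧ w (ex₁ m))
      ≡⟨ cong₂ _xor_ (sumMono-point N (suc j) _ (endpoint-degree a) w)
                     (sumMono-point N (suc j) _ (endpoint-degree b) w) ⟩
    w (incr a (ex g)) xor w (incr b (ex g)) ∎
    where
    at : Vec ℕ N → Mono N (suc j) → Bool
    at v m = eqV (ex₁ m) v
    endpoint-degree : ∀ c → degree (incr c (ex g)) ≡ suc j
    endpoint-degree c = trans (degree-incr c (ex g)) (cong suc (degree-exps N j g))

  δ-adjoint : (S : EdgeSpaceK G j) (w : Vec ℕ N → Bool) →
    sumMono N (suc j) (λ m → δ G j S m ∧ w (ex₁ m)) ≡
    sumEdgeG G (λ e → sumMono N j (λ g → S (e , g) ∧ (w (end₁ G j (e , g)) xor w (end₂ G j (e , g)))))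
  δ-adjoint S w = begin
    sumMono N (suc j) (λ m → δ G j S m ∧ w (ex₁ m))
      ≡⟨ sum-cong finM₁ (λ m → trans (≡-sym (sum-∧ʳ finE (w (ex₁ m)) _))
                                     (sum-cong finE (λ e → ≡-sym (sum-∧ʳ finM (w (ex₁ m)) _)))) ⟩
    sumMono N (suc j) (λ m → sumEdgeG G (λ e → sumMono N j (λ g → term e g m)))
      ≡⟨ sum-swap finM₁ finE (λ m e → sumMono N j (λ g → term e g m)) ⟩
    sumEdgeG G (λ e → sumMono N (suc j) (λ m → sumMono N j (λ g → term e g m)))
      ≡⟨ sum-cong finE (λ e → sum-swap finM₁ finM (λ m g → term e g m)) ⟩
    sumEdgeG G (λ e → sumMono N j (λ g → sumMono N (suc j) (λ m → term e g m)))
      ≡⟨ sum-cong finE (λ e → sum-cong finM (λ g →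
           trans (sum-cong finM₁ (λ m → ∧-assoc (S (e , g)) (incidentK (e , g) m) (w (ex₁ m))))
                 (sum-∧ˡ finM₁ (S (e , g)) (λ m → incidentK (e , g) m ∧ w (ex₁ m))))) ⟩
    sumEdgeG G (λ e → sumMono N j (λ g → S (e , g) ∧ sumMono N (suc j) (λ m → incidentK (e , g) m ∧ w (ex₁ m))))
      ≡⟨ sum-cong finE (λ e → sum-cong finM (λ g → cong (S (e , g) ∧_) (incidentK-sum (e , g) w))) ⟩
    sumEdgeG G (λ e → sumMono N j (λ g → S (e , g) ∧ (w (end₁ G j (e , g)) xor w (end₂ G j (e , g))))) ∎
    where
    term : EdgeG G → Mono N j → Mono N (suc j) → Bool
    term e g m = (S (e , g) ∧ incidentK (e , g) m) ∧ w (ex₁ m)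

  δ-xor : (S S′ : EdgeSpaceK G j) (m : Mono N (suc j)) →
    δ G j (λ ε → S ε xor S′ ε) m ≡ δ G j S m xor δ G j S′ m
  δ-xor S S′ m = trans
    (sum-cong finE (λ e → trans (sum-cong finM (λ g → ∧-distribʳ-xor (incidentK (e , g) m) (S (e , g)) (S′ (e , g))))
                                (sum-xor finM _ _)))
    (sum-xor finE _ _)

  pstar-xor : (S S′ : EdgeSpaceK G j) (e : EdgeG G) →
    pstar G j (λ ε → S ε xor S′ ε) e ≡ pstar G j S e xor pstar G j S′ e
  pstar-xor S S′ e = sum-xor finM (λ g → S (e , g)) (λ g → S′ (e , g))

  -- p* maps cycles to cycles: weight m by the parity of its exponent of x.
  pstar-cycle : (S : EdgeSpaceK G j) → IsCycle G j S → IsCycleG G (pstar G j S)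
  pstar-cycle S S-cycle x = begin
    sumEdgeG G (λ e → pstar G j S e ∧ incident G e x)
      ≡⟨ sum-cong finE (λ e → ≡-sym (sum-∧ʳ finM (incident G e x) (λ g → S (e , g)))) ⟩
    sumEdgeG G (λ e → sumMono N j (λ g → S (e , g) ∧ incident G e x))
      ≡⟨ sum-cong finE (λ e → sum-cong finM (λ g → cong (S (e , g) ∧_) (≡-sym (parity-jump e g)))) ⟩
    sumEdgeG G (λ e → sumMono N j (λ g → S (e , g) ∧ (w (end₁ G j (e , g)) xor w (end₂ G j (e , g)))))
      ≡⟨ ≡-sym (δ-adjoint S w) ⟩
    sumMono N (suc j) (λ m → δ G j S m ∧ w (ex₁ m))
      ≡⟨ sum-zero finM₁ (λ m → cong (_∧ w (ex₁ m)) (S-cycle m)) ⟩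
    false ∎
    where
    w : Vec ℕ N → Bool
    w v = odd (lookup v x)
    parity-jump : ∀ e g → w (end₁ G j (e , g)) xor w (end₂ G j (e , g)) ≡ incident G e x
    parity-jump (a , b , _) g =
      trans (cong₂ _xor_ (odd-incr a x (ex g)) (odd-incr b x (ex g)))
            (xor-cancelʳ (kron a x) (kron b x) (odd (lookup (ex g) x)))

  module _ (f : Mono N j) where

    lift : EdgeSpaceG G → EdgeSpaceK G j
    lift P (e , g) = eqV (ex g) (ex f) ∧ P e

    pstar-lift : (P : EdgeSpaceG G) (e : EdgeG G) → pstar G j (lift P) e ≡ P e
    pstar-lift P e = sumMono-kron N j f (λ _ → P e)

    lift-in-Gf : (P : EdgeSpaceG G) (ε : EdgeK G j) → lift P ε ≡ true → InGf G j f ε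
    lift-in-Gf P ((a , b , _) , g) lifted = (a , cong (incr a) g≈f) , (b , cong (incr b) g≈f)
      where
      g≈f : ex g ≡ ex f
      g≈f = eqV-sound (ex g) (ex f) (proj₁ (Equivalence.to T-∧ (Equivalence.from T-≡ lifted)))

    copyVertex : Mono N (suc j) → Fin N → Bool
    copyVertex m x = eqV (ex₁ m) (incr x (ex f))

    incidentK-copy : (e : EdgeG G) (m : Mono N (suc j)) →
      incidentK (e , f) m ≡ sumFin (λ x → incident G e x ∧ copyVertex m x)
    incidentK-copy (a , b , _) m = ≡-sym (begin
      sumFin (λ x → (kron a x xor kron b x) ∧ copyVertex m x)
        ≡⟨ sum-cong finF (λ x → ∧-distribʳ-xor (copyVertex m x) (kron a x) (kron b x)) ⟩
      sumFin (λ x → (kron a x ∧ copyVertex m x) xor (kron b x ∧ copyVertex m x))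
        ≡⟨ sum-xor finF (λ x → kron a x ∧ copyVertex m x) (λ x → kron b x ∧ copyVertex m x) ⟩
      sumFin (λ x → kron a x ∧ copyVertex m x) xor sumFin (λ x → kron b x ∧ copyVertex m x)
        ≡⟨ cong₂ _xor_ (sumFin-kron a (copyVertex m)) (sumFin-kron b (copyVertex m)) ⟩
      copyVertex m a xor copyVertex m b ∎)

    δ-lift : (P : EdgeSpaceG G) (m : Mono N (suc j)) →
      δ G j (lift P) m ≡ sumFin (λ x → copyVertex m x ∧ ∂G G P x)
    δ-lift P m = begin
      sumEdgeG G (λ e → sumMono N j (λ g → (eqV (ex g) (ex f) ∧ P e) ∧ incidentK (e , g) m))
        ≡⟨ sum-cong finE (λ e →
             trans (sum-cong finM (λ g → ∧-assoc (eqV (ex g) (ex f)) (P e) (incidentK (e , g) m)))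
                   (sumMono-kron N j f (λ g → P e ∧ incidentK (e , g) m))) ⟩
      sumEdgeG G (λ e → P e ∧ incidentK (e , f) m)
        ≡⟨ sum-cong finE (λ e → cong (P e ∧_) (incidentK-copy e m)) ⟩
      sumEdgeG G (λ e → P e ∧ sumFin (λ x → incident G e x ∧ copyVertex m x))
        ≡⟨ sum-cong finE (λ e →
             trans (≡-sym (sum-∧ˡ finF (P e) (λ x → incident G e x ∧ copyVertex m x)))
                   (sum-cong finF (λ x → ∧-rotate (P e) (incident G e x) (copyVertex m x)))) ⟩
      sumEdgeG G (λ e → sumFin (λ x → copyVertex m x ∧ (P e ∧ incident G e x)))
        ≡⟨ sum-swap finE finF (λ e x → copyVertex m x ∧ (P e ∧ incident G e x)) ⟩
      sumFin (λ x → sumEdgeG G (λ e → copyVertex m x ∧ (P e ∧ incident G e x)))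
        ≡⟨ sum-cong finF (λ x → sum-∧ˡ finE (copyVertex m x) (λ e → P e ∧ incident G e x)) ⟩
      sumFin (λ x → copyVertex m x ∧ ∂G G P x) ∎

    lift-cycle : (P : EdgeSpaceG G) → IsCycleG G P → IsCycle G j (lift P)
    lift-cycle P P-cycle m =
      trans (δ-lift P m) (sum-zero finF (λ x → trans (cong (copyVertex m x ∧_) (P-cycle x)) (∧-zeroʳ _)))

    -- An edge (ab , g) of Gf lies in the fibre g = f, since a ≠ b.
    Gf-fibre : (ε : EdgeK G j) → InGf G j f ε → ex (proj₂ ε) ≡ ex f
    Gf-fibre ((a , b , ab∈E) , g) ((x , ag≡xf) , (y , bg≡yf)) =
      incr-common-cofactor a b x y (ex g) (ex f) (edge-endpoints-distinct G a b ab∈E) ag≡xf bg≡yf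

    -- Existence: S = lift (p* S) + (lift (p* S) + S).
    decomposition : (S : EdgeSpaceK G j) → IsCycle G j S →
      Σ (EdgeSpaceK G j) λ X → Σ (EdgeSpaceK G j) λ Y →
        InCGf G j f X × InKerP G j Y × (∀ ε → S ε ≡ X ε xor Y ε)
    decomposition S S-cycle = X , Y , (X-cycle , lift-in-Gf P) , (Y-cycle , Y-kernel) , λ ε → xor-involutive (X ε) (S ε)
      where
      P = pstar G j S
      X = lift P
      Y : EdgeSpaceK G j
      Y ε = X ε xor S ε
      X-cycle : IsCycle G j X
      X-cycle = lift-cycle P (pstar-cycle S S-cycle)
      Y-cycle : IsCycle G j Y
      Y-cycle m = trans (δ-xor X S m) (cong₂ _xor_ (X-cycle m) (S-cycle m))
      Y-kernel : ∀ e → pstar G j Y e ≡ false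
      Y-kernel e = trans (pstar-xor X S e) (trans (cong (_xor P e) (pstar-lift P e)) (xor-same (P e)))

    -- Uniqueness: a cycle of Gf lives on the fibre f, where p* loses nothing.
    intersection-trivial : (S : EdgeSpaceK G j) → InCGf G j f S → InKerP G j S → ∀ ε → S ε ≡ false
    intersection-trivial S (_ , S-in-Gf) (_ , S-in-ker) (e , g) with S (e , g) in Seg
    ... | false = refl
    ... | true  = contradiction (trans (≡-sym pstarS≡true) (S-in-ker e)) λ ()
      where
      same-fibre : ∀ g′ → S (e , g′) ≡ true → ex g′ ≡ ex g
      same-fibre g′ Seg′ = trans (Gf-fibre (e , g′) (S-in-Gf (e , g′) Seg′))
                                 (≡-sym (Gf-fibre (e , g) (S-in-Gf (e , g) Seg)))
      pstarS≡true : pstar G j S e ≡ true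
      pstarS≡true = trans (sumMono-concentrated N j g (λ g′ → S (e , g′)) same-fibre) Seg

proposition3 : (G : Graph) (j : ℕ) (f : Mono (n G) j) →
    ((S : EdgeSpaceK G j) → IsCycle G j S →
      Σ (EdgeSpaceK G j) λ X → Σ (EdgeSpaceK G j) λ Y →
        InCGf G j f X × InKerP G j Y × (∀ e → S e ≡ X e xor Y e))
    × ((S : EdgeSpaceK G j) → InCGf G j f S → InKerP G j S → ∀ e → S e ≡ false)
proposition3 G j f = decomposition G j f , intersection-trivial G j f
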